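{- Let $(G,p)$ be a polarized diagram and let $\mathcal{R}_{(G,p)}:=(V(G),\emptyset,E(G),p)$. Then for every PRN $\mathcal{R}$, we have $\mathcal{R}_{(G,p)}\hookrightarrow^{*}\mathcal{R}$ if and only if $\mathcal{R}$ is a strict polarized rectifier network realizing $(G,p)$.
   Context: A diagram is a loopless graph with undirected and directed edges such that for all $u,v$ at most one of $\{u,v\},(u,v),(v,u)$ is an edge. A polarized diagram of a diagram is a pair $(G,p)$ where $G$ is the directed graph obtained by orienting each undirected edge arbitrarily and $p:E(G)\to\{ -,+\}$ assigns $-$ to formerly undirected edges and $+$ to originally directed edges. A polarized rectifier network (PRN) is $\mathcal{R}=(B,A,E,p)$ with $B,A$ disjoint vertex sets (base and auxiliary), $(B\sqcup A,E)$ a loopless directed graph, and $p:\{(u,v)\in E: v\in B\}\to\{ -,+\}$. For $u,v\in B$ (possibly equal), a valid walk from $u$ to $v$ is a sequence $(\pi_1,\dots,\pi_k)$, $k\ge2$, with $\pi_1=u$, $\pi_k=v$, each $(\pi_i,\pi_{i+1})\in E$, and $\pi_i\in A$ for $2\le i\le k-1$; its polarity is $p(\pi_{k-1},\pi_k)$. A PRN $(V(G),A,E,p')$ realizes $(G,p)$ if for all $u,v\in V(G)$ (possibly equal), $(u,v)\in E(G)$ iff there is a valid walk from $u$ to $v$ with polarity $p(u,v)$ (and there is no valid walk from $u$ to $v$ when $(u,v)\notin E(G)$). A PRN is strict if (1) for every 2-element $\{u,v\}\subseteq B$ there is at most one valid walk from $u$ to $v$ or from $v$ to $u$ in total, and (2)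 every vertex of $A$ lies on some valid walk. A coherent biclique of a PRN $(B,A,E,p)$ is a pair $(X,Y)$ of disjoint nonempty subsets of $B\sqcup A$ such that $(x,y)\in E$ for all $x\in X,y\in Y$, and $p(x_1,y)=p(x_2,y)$ for all $y\in Y\cap B$ and $x_1,x_2\in X$. The biclique reduction of $\mathcal{R}$ with respect to $(X,Y)$ is the PRN $(B,A\sqcup\{z\},E',p')$ for a new vertex $z$, where $E'=(E\setminus(X\times Y))\cup\{(x,z):x\in X\}\cup\{(z,y):y\in Y\}$, $p'(z,y)=p(x,y)$ for $y\in Y\cap B$ (for any $x\in X$), and $p'=p$ otherwise. We write $\mathcal{R}\hookrightarrow\mathcal{R}'$ if $\mathcal{R}'$ is a biclique reduction of $\mathcal{R}$, and $\hookrightarrow^{*}$ for the reflexive transitive closure (with PRNs identified up to the naming of new auxiliary vertices). -}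

module Defs where

open import Data.Nat using (ℕ; zero; suc)
open import Data.Fin using (Fin; zero; suc)
open import Data.Sum using (_⊎_; inj₁; inj₂; map₂)
open import Data.Bool using (Bool; true; false; _∧_; not; if_then_else_)
open import Data.Maybe using (Maybe; just; nothing)
open import Data.List using (List; []; _∷_)
open import Data.List.Membership.Propositional using (_∈_)
open import Data.Product using (Σ; ∃; _×_; _,_)
open import Data.Empty using (⊥)
open import Relation.Nullary using (¬_)
open import Relation.Binary.PropositionalEquality using (_≡_; _≢_)
open import Function.Bundles using (_↔_; Inverse)

data Pol : Set where
  neg pos : Pol

-- Diagrams on the vertex set Fin n.
-- und u v : {u,v} is an undirected edge;  dir u v : (u,v) is a directed edge.

record Diagram (n : ℕ) : Set where
  field
    und      : Fin n → Fin n → Bool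
    dir      : Fin n → Fin n → Bool
    und-sym  : ∀ u v → und u v ≡ und v u
    und-irr  : ∀ u → und u u ≡ false
    dir-irr  : ∀ u → dir u u ≡ false
    -- at most one of {u,v}, (u,v), (v,u) is an edge
    und-dir  : ∀ u v → und u v ≡ true → dir u v ≡ false
    dir-asym : ∀ u v → dir u v ≡ true → dir v u ≡ false

-- A polarized directed graph on Fin n: EG u v ≡ just q  iff  (u,v) ∈ E(G) and p(u,v) = q.
PolGraph : ℕ → Set
PolGraph n = Fin n → Fin n → Maybe Pol

record IsPolarization {n : ℕ} (D : Diagram n) (EG : PolGraph n) : Set where
  open Diagram D
  field
    pos-dir  : ∀ u v → EG u v ≡ just pos → dir u v ≡ true
    dir-pos  : ∀ u v → dir u v ≡ true → EG u v ≡ just pos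
    neg-und  : ∀ u v → EG u v ≡ just neg → und u v ≡ true
    und-neg  : ∀ u v → und u v ≡ true → (EG u v ≡ just neg) ⊎ (EG v u ≡ just neg)
    one-way  : ∀ u v → EG u v ≡ just neg → EG v u ≢ just neg

-- Polarized rectifier networks with base set B = Fin n and auxiliary
-- set A = Fin m.  Eaux x a : (x,a) ∈ E ;  Ebase x b ≡ just q : (x,b) ∈ E with p(x,b) = q.

record PRN (n : ℕ) : Set where
  field
    m     : ℕ
    Eaux  : Fin n ⊎ Fin m → Fin m → Bool
    Ebase : Fin n ⊎ Fin m → Fin n → Maybe Pol

Vtx : {n : ℕ} → PRN n → Set
Vtx {n} R = Fin n ⊎ Fin (PRN.m R)

Loopless : {n : ℕ} → PRN n → Set
Loopless R = (∀ a → Eaux (inj₂ a) a ≡ false) × (∀ b → Ebase (inj₁ b) b ≡ nothing)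
  where open PRN R

initialPRN : {n : ℕ} → PolGraph n → PRN n
initialPRN EG = record { m = 0 ; Eaux = λ _ () ; Ebase = eb }
  where
    eb : _ → _ → Maybe Pol
    eb (inj₁ u) v = EG u v
    eb (inj₂ ()) v

-- Valid walks.  A walk u, a₁, …, a_k, v is given by the list of its
-- auxiliary (inner) vertices; Path x as v q says the walk from x through
-- as to v exists and its last edge has polarity q.

Path : {n : ℕ} (R : PRN n) → Vtx R → List (Fin (PRN.m R)) → Fin _ → Pol → Set
Path R x []       v q = PRN.Ebase R x v ≡ just q
Path R x (a ∷ as) v q = (PRN.Eaux R x a ≡ true) × Path R (inj₂ a) as v q

WalkPol : {n : ℕ} (R : PRN n) → Fin n → List (Fin (PRN.m R)) → Fin n → Pol → Set
WalkPol R u as v q = Path R (inj₁ u) as v q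

Walk : {n : ℕ} (R : PRN n) → Fin n → List (Fin (PRN.m R)) → Fin n → Set
Walk R u as v = Σ Pol (WalkPol R u as v)

Strict : {n : ℕ} → PRN n → Set
Strict {n} R =
  (∀ (u v : Fin n) → u ≢ v → ∀ as bs → Walk R u as v → Walk R u bs v → as ≡ bs)
  × (∀ (u v : Fin n) → u ≢ v → ∀ as bs → Walk R u as v → Walk R v bs u → ⊥)
  × (∀ (a : Fin (PRN.m R)) → Σ (Fin n) λ u → Σ (Fin n) λ v → Σ (List (Fin (PRN.m R))) λ as →
        Walk R u as v × a ∈ as)

Realizes : {n : ℕ} → PRN n → PolGraph n → Set
Realizes {n} R EG = ∀ (u v : Fin n) →
  (∀ q → EG u v ≡ just q → ∃ λ as → WalkPol R u as v q)
  × (EG u v ≡ nothing → ∀ as → ¬ Walk R u as v)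

record CoherentBiclique {n : ℕ} (R : PRN n) : Set where
  open PRN R
  field
    X Y       : Vtx R → Bool
    x₀        : Vtx R
    x₀∈X      : X x₀ ≡ true
    Y-ne      : ∃ λ y → Y y ≡ true
    disjoint  : ∀ v → X v ≡ true → Y v ≡ true → ⊥
    full-aux  : ∀ x a → X x ≡ true → Y (inj₂ a) ≡ true → Eaux x a ≡ true
    full-base : ∀ x b → X x ≡ true → Y (inj₁ b) ≡ true → Ebase x b ≢ nothing
    coherent  : ∀ x₁ x₂ b → X x₁ ≡ true → X x₂ ≡ true → Y (inj₁ b) ≡ true →
                Ebase x₁ b ≡ Ebase x₂ b

-- The new vertex z is the auxiliary vertex zero; old auxiliary a becomes suc a.
back : {n m : ℕ} → Fin n ⊎ Fin (suc m) → Maybe (Fin n ⊎ Fin m)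
back (inj₁ b)       = just (inj₁ b)
back (inj₂ zero)    = nothing
back (inj₂ (suc a)) = just (inj₂ a)

module _ {n : ℕ} (R : PRN n) (β : CoherentBiclique R) where
  open PRN R
  open CoherentBiclique β

  newAux : Maybe (Vtx R) → Fin (suc m) → Bool
  newAux nothing  zero    = false
  newAux nothing  (suc a) = Y (inj₂ a)
  newAux (just x) zero    = X x
  newAux (just x) (suc a) = Eaux x a ∧ not (X x ∧ Y (inj₂ a))

  newBase : Maybe (Vtx R) → Fin n → Maybe Pol
  newBase nothing  b = if Y (inj₁ b) then Ebase x₀ b else nothing
  newBase (just x) b = if X x ∧ Y (inj₁ b) then nothing else Ebase x b

  reduce : PRN n
  reduce = record
    { m     = suc m
    ; Eaux  = λ u a → newAux (back u) a
    ; Ebase = λ u b → newBase (back u) b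
    }

record _≅_ {n : ℕ} (R R' : PRN n) : Set where
  field
    σ : Fin (PRN.m R) ↔ Fin (PRN.m R')
  f : Fin (PRN.m R) → Fin (PRN.m R')
  f = Inverse.to σ
  field
    pres-aux  : ∀ u a → PRN.Eaux R u a ≡ PRN.Eaux R' (map₂ f u) (f a)
    pres-base : ∀ u b → PRN.Ebase R u b ≡ PRN.Ebase R' (map₂ f u) b

data _↪*_ {n : ℕ} : PRN n → PRN n → Set where
  done : ∀ {R R'} → R ≅ R' → R ↪* R'
  step : ∀ {R R'} (β : CoherentBiclique R) → reduce R β ↪* R' → R ↪* R'

-- A biclique reduction changes valid walks only by inserting the new vertex
-- wherever a walk passes from X to Y, so it preserves strictness and
-- realization; the initial network has both because a polarized diagram has no
-- loops and no 2-cycles.  Conversely, in a strict network realizing (G,p) every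
-- auxiliary vertex z lies on a valid walk, so any two paths from a vertex to a
-- base vertex coincide.  Hence the in-neighbours X and out-neighbours Y of z
-- are disjoint and no edge of X × Y is present besides the detour through z:
-- replacing z by X × Y yields a smaller strict realizing network of which the
-- given one is the biclique reduction along (X,Y).  Induction on the number of
-- auxiliary vertices concludes.
module Submission where

open import Defs
open import Data.Nat using (ℕ; zero; suc)
open import Data.Fin using (Fin; zero; suc; _≟_)
open import Data.Sum using (_⊎_; inj₁; inj₂; map₂)
open import Data.Bool using (Bool; true; false; _∧_; _∨_; not; if_then_else_)
open import Data.Maybe using (Maybe; just; nothing; is-just)
open import Data.Bool.Properties using (∧-identityʳ; ∧-zeroʳ; ∨-identityʳ; ∨-zeroʳ; ¬-not)
open import Data.List using (List; []; _∷_; _++_; [_]; map)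
open import Data.List.Properties using (++-assoc; ++-cancelˡ; ++-identityˡ-unique; ∷-injectiveˡ; map-∘; map-cong; map-id)
open import Data.List.Membership.Propositional using (_∈_)
open import Data.List.Membership.Propositional.Properties using (∈-map⁺; ∈-++⁺ʳ)
open import Data.List.Relation.Unary.Any using (here; there)
open import Data.Product using (∃; ∃₂; _×_; _,_; proj₁; proj₂)
open import Data.Empty using (⊥; ⊥-elim)
open import Relation.Nullary using (Dec; yes; no)
open import Relation.Binary.PropositionalEquality hiding ([_])
open import Function using (case_of_)
open import Function.Bundles using (Inverse; _⇔_; mk⇔; mk↔ₛ′)
open import Function.Properties.Inverse using (↔-refl; ↔-sym; ↔-trans)

∧-true⁻ : ∀ {a b} → a ∧ b ≡ true → a ≡ true × b ≡ true
∧-true⁻ {true} b≡true = refl , b≡true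

∨-∧-not-cancel : ∀ e c → (c ≡ true → e ≡ false) → (e ∨ c) ∧ not c ≡ e
∨-∧-not-cancel e true  c⇒¬e = trans (∧-zeroʳ (e ∨ true)) (sym (c⇒¬e refl))
∨-∧-not-cancel e false _    = trans (∧-identityʳ (e ∨ false)) (∨-identityʳ e)

is-just⇒just : ∀ {A : Set} {mx : Maybe A} → is-just mx ≡ true → ∃ λ x → mx ≡ just x
is-just⇒just {mx = just x} _ = x , refl

LoopFree : {n : ℕ} → PolGraph n → Set
LoopFree {n} EG = ∀ (u : Fin n) → EG u u ≡ nothing

module Walks {n : ℕ} (R : PRN n) where
  open PRN R

  AuxPath : Vtx R → List (Fin m) → Fin m → Set
  AuxPath x []       a = Eaux x a ≡ true
  AuxPath x (b ∷ bs) a = Eaux x b ≡ true × AuxPath (inj₂ b) bs a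

  Path-split : ∀ {x as v q a} → Path R x as v q → a ∈ as →
               ∃₂ λ pre suf → AuxPath x pre a × Path R (inj₂ a) suf v q
  Path-split {as = b ∷ bs} (e , p) (here refl) = [] , bs , e , p
  Path-split {as = b ∷ bs} (e , p) (there a∈bs) =
    let pre , suf , e⁺ , p′ = Path-split p a∈bs in b ∷ pre , suf , (e , e⁺) , p′

  Path-join : ∀ {x pre a suf v q} → AuxPath x pre a → Path R (inj₂ a) suf v q →
              Path R x (pre ++ a ∷ suf) v q
  Path-join {pre = []}    e        p = e , p
  Path-join {pre = _ ∷ _} (e , e⁺) p = e , Path-join e⁺ p

  Path-inEdge : ∀ {x as v q a} → Path R x as v q → a ∈ as → ∃ λ w → Eaux w a ≡ true
  Path-inEdge {x} (e , _) (here refl) = x , e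
  Path-inEdge     (_ , p) (there a∈as) = Path-inEdge p a∈as

  OnWalk : Fin m → Set
  OnWalk a = ∃₂ λ u v → ∃ λ as → Walk R u as v × a ∈ as

  record Entry (x : Vtx R) : Set where
    field
      source : Fin n
      prefix : List (Fin m)
      extend : ∀ {ls v q} → Path R x ls v q → WalkPol R source (prefix ++ ls) v q

  Exit : Vtx R → Set
  Exit x = ∃₂ λ v ls → ∃ λ q → Path R x ls v q

  entry-base : ∀ u → Entry (inj₁ u)
  entry-base u = record { source = u ; prefix = [] ; extend = λ p → p }

  onWalk-entry : ∀ {a} → OnWalk a → Entry (inj₂ a)
  onWalk-entry {a} (u , _ , _ , (_ , p) , a∈as) =
    let pre , _ , e⁺ , _ = Path-split p a∈as
    in record { source = u ; prefix = pre ++ [ a ]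
              ; extend = λ {ls} {v} {q} p′ →
                  subst (λ l → WalkPol R u l v q) (sym (++-assoc pre [ a ] ls)) (Path-join e⁺ p′) }

  entry : (∀ a → OnWalk a) → ∀ x → Entry x
  entry onWalk (inj₁ u) = entry-base u
  entry onWalk (inj₂ a) = onWalk-entry (onWalk a)

  onWalk-exit : ∀ {a} → OnWalk a → Exit (inj₂ a)
  onWalk-exit (_ , v , _ , (q , p) , a∈as) =
    let _ , suf , _ , p′ = Path-split p a∈as in v , suf , q , p′

  -- Prefixed by an entry into x, the two paths become valid walks, which are
  -- either loops or subject to strictness (1).
  Path-unique : ∀ {EG} → LoopFree EG → Strict R → Realizes R EG →
                ∀ {x l₁ l₂ v q₁ q₂} → Path R x l₁ v q₁ → Path R x l₂ v q₂ → l₁ ≡ l₂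
  Path-unique loopFree (unique , _ , onWalk) realizes {x} {l₁} {l₂} {v} p₁ p₂ = by-cases (source ≟ v)
    where
    open Entry (entry onWalk x)
    by-cases : Dec (source ≡ v) → l₁ ≡ l₂
    by-cases (yes refl) = ⊥-elim (proj₂ (realizes v v) (loopFree v) _ (_ , extend p₁))
    by-cases (no u≢v)   = ++-cancelˡ prefix l₁ l₂ (unique _ v u≢v _ _ (_ , extend p₁) (_ , extend p₂))

record WalkEmbedding {n : ℕ} (R R′ : PRN n) : Set where
  field
    embed   : Fin n → List (Fin (PRN.m R)) → Fin n → List (Fin (PRN.m R′))
    retract : Fin n → List (Fin (PRN.m R′)) → Fin n → List (Fin (PRN.m R))
    embed-walk    : ∀ {u as v q} → WalkPol R u as v q → WalkPol R′ u (embed u as v) v q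
    retract-embed : ∀ {u as v q} → WalkPol R u as v q → retract u (embed u as v) v ≡ as

  embed-Walk : ∀ {u as v} → Walk R u as v → Walk R′ u (embed u as v) v
  embed-Walk (q , p) = q , embed-walk p

module _ {n : ℕ} {R R′ : PRN n} where

  strict-reflect : WalkEmbedding R R′ → Strict R′ → (∀ a → Walks.OnWalk R a) → Strict R
  strict-reflect E (unique , oneWay , _) onWalk = unique′ , oneWay′ , onWalk
    where
    open WalkEmbedding E
    open ≡-Reasoning
    unique′ : ∀ u v → u ≢ v → ∀ as bs → Walk R u as v → Walk R u bs v → as ≡ bs
    unique′ u v u≢v as bs w@(_ , p) w′@(_ , p′) = begin
      as                         ≡⟨ retract-embed p ⟨
      retract u (embed u as v) v ≡⟨ cong (λ l → retract u l v) (unique u v u≢v _ _ (embed-Walk w) (embed-Walk w′)) ⟩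
      retract u (embed u bs v) v ≡⟨ retract-embed p′ ⟩
      bs                         ∎
    oneWay′ : ∀ u v → u ≢ v → ∀ as bs → Walk R u as v → Walk R v bs u → ⊥
    oneWay′ u v u≢v _ _ w w′ = oneWay u v u≢v _ _ (embed-Walk w) (embed-Walk w′)

  realizes-transfer : ∀ {EG} → WalkEmbedding R R′ → WalkEmbedding R′ R → Realizes R EG → Realizes R′ EG
  realizes-transfer E E′ realizes u v =
      (λ q uv∈G → let _ , p = proj₁ (realizes u v) q uv∈G in _ , WalkEmbedding.embed-walk E p)
    , (λ uv∉G _ w → proj₂ (realizes u v) uv∉G _ (WalkEmbedding.embed-Walk E′ w))

module Renaming {n : ℕ} {R R′ : PRN n} (i : R ≅ R′) where
  open _≅_ i

  g : Fin (PRN.m R′) → Fin (PRN.m R)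
  g = Inverse.from σ

  f∘g : ∀ a → f (g a) ≡ a
  f∘g = Inverse.strictlyInverseˡ σ

  g∘f : ∀ a → g (f a) ≡ a
  g∘f = Inverse.strictlyInverseʳ σ

  map₂-f∘g : ∀ (u : Vtx R′) → map₂ f (map₂ g u) ≡ u
  map₂-f∘g (inj₁ _) = refl
  map₂-f∘g (inj₂ a) = cong inj₂ (f∘g a)

module _ {n : ℕ} where

  ≅-sym : {R R′ : PRN n} → R ≅ R′ → R′ ≅ R
  ≅-sym {R} {R′} i = record
    { σ         = ↔-sym σ
    ; pres-aux  = λ u a → trans (sym (cong₂ (PRN.Eaux R′) (map₂-f∘g u) (f∘g a))) (sym (pres-aux (map₂ g u) (g a)))
    ; pres-base = λ u b → trans (sym (cong (λ w → PRN.Ebase R′ w b) (map₂-f∘g u))) (sym (pres-base (map₂ g u) b))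
    }
    where
    open _≅_ i
    open Renaming i

  ≅-trans : {R₁ R₂ R₃ : PRN n} → R₁ ≅ R₂ → R₂ ≅ R₃ → R₁ ≅ R₃
  ≅-trans {R₃ = R₃} i j = record
    { σ         = ↔-trans (_≅_.σ i) (_≅_.σ j)
    ; pres-aux  = λ u a → trans (_≅_.pres-aux i u a)
                            (trans (_≅_.pres-aux j _ _) (cong (λ w → PRN.Eaux R₃ w _) (map₂-∘ u)))
    ; pres-base = λ u b → trans (_≅_.pres-base i u b)
                            (trans (_≅_.pres-base j _ b) (cong (λ w → PRN.Ebase R₃ w b) (map₂-∘ u)))
    }
    where
    map₂-∘ : ∀ u → map₂ (_≅_.f j) (map₂ (_≅_.f i) u) ≡ map₂ (λ a → _≅_.f j (_≅_.f i a)) u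
    map₂-∘ (inj₁ _) = refl
    map₂-∘ (inj₂ _) = refl

  ≅-embedding : {R R′ : PRN n} → R ≅ R′ → WalkEmbedding R R′
  ≅-embedding {R} {R′} i = record
    { embed         = λ _ as _ → map f as
    ; retract       = λ _ bs _ → map g bs
    ; embed-walk    = Path-rename
    ; retract-embed = λ {_} {as} _ → trans (sym (map-∘ as)) (trans (map-cong g∘f as) (map-id as))
    }
    where
    open _≅_ i
    open Renaming i
    Path-rename : ∀ {x as v q} → Path R x as v q → Path R′ (map₂ f x) (map f as) v q
    Path-rename {x} {[]}     p       = trans (sym (pres-base x _)) p
    Path-rename {x} {a ∷ as} (e , p) = trans (sym (pres-aux x a)) e , Path-rename p

  strict-≅ : {R R′ : PRN n} → R ≅ R′ → Strict R → Strict R′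
  strict-≅ {R} {R′} i s@(_ , _ , onWalk) = strict-reflect (≅-embedding (≅-sym i)) s onWalk′
    where
    open _≅_ i
    open Renaming i
    onWalk′ : ∀ a → Walks.OnWalk R′ a
    onWalk′ a =
      let u , v , as , w , ga∈as = onWalk (g a)
      in u , v , map f as , WalkEmbedding.embed-Walk (≅-embedding i) w , subst (_∈ map f as) (f∘g a) (∈-map⁺ f ga∈as)

  realizes-≅ : ∀ {EG} {R R′ : PRN n} → R ≅ R′ → Realizes R EG → Realizes R′ EG
  realizes-≅ i = realizes-transfer (≅-embedding i) (≅-embedding (≅-sym i))

prn : ∀ {n} k → (Fin n ⊎ Fin k → Fin k → Bool) → (Fin n ⊎ Fin k → Fin n → Maybe Pol) → PRN n
prn k Ea Eb = record { m = k ; Eaux = Ea ; Ebase = Eb }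

pointwise-≅ : ∀ {n k} {Ea Ea′ : Fin n ⊎ Fin k → Fin k → Bool} {Eb Eb′ : Fin n ⊎ Fin k → Fin n → Maybe Pol} →
              (∀ u a → Ea u a ≡ Ea′ u a) → (∀ u b → Eb u b ≡ Eb′ u b) → prn k Ea Eb ≅ prn k Ea′ Eb′
pointwise-≅ aux base = record
  { σ         = ↔-refl
  ; pres-aux  = λ { (inj₁ u) → aux (inj₁ u) ; (inj₂ c) → aux (inj₂ c) }
  ; pres-base = λ { (inj₁ u) → base (inj₁ u) ; (inj₂ c) → base (inj₂ c) }
  }

-- Walks of O become walks of reduce O β by inserting z wherever a walk steps
-- from X to Y, and walks of reduce O β go back by erasing z.
module Reduction {n : ℕ} (O : PRN n) (β : CoherentBiclique O) where
  open PRN O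
  open CoherentBiclique β

  N : PRN n
  N = reduce O β

  emb : Vtx O → Vtx N
  emb = map₂ suc

  z : Vtx N
  z = inj₂ zero

  Eaux-into-z : ∀ x → PRN.Eaux N (emb x) zero ≡ X x
  Eaux-into-z (inj₁ _) = refl
  Eaux-into-z (inj₂ _) = refl

  Eaux-emb-kept : ∀ {x a} → X x ∧ Y (inj₂ a) ≡ false → PRN.Eaux N (emb x) (suc a) ≡ Eaux x a
  Eaux-emb-kept {inj₁ _} {a} XY rewrite XY = ∧-identityʳ (Eaux _ a)
  Eaux-emb-kept {inj₂ _} {a} XY rewrite XY = ∧-identityʳ (Eaux _ a)

  Eaux-emb-cut : ∀ {x a} → X x ∧ Y (inj₂ a) ≡ true → PRN.Eaux N (emb x) (suc a) ≡ false
  Eaux-emb-cut {inj₁ _} {a} XY rewrite XY = ∧-zeroʳ (Eaux _ a)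
  Eaux-emb-cut {inj₂ _} {a} XY rewrite XY = ∧-zeroʳ (Eaux _ a)

  Ebase-emb-kept : ∀ {x b} → X x ∧ Y (inj₁ b) ≡ false → PRN.Ebase N (emb x) b ≡ Ebase x b
  Ebase-emb-kept {inj₁ _} XY rewrite XY = refl
  Ebase-emb-kept {inj₂ _} XY rewrite XY = refl

  Ebase-emb-cut : ∀ {x b} → X x ∧ Y (inj₁ b) ≡ true → PRN.Ebase N (emb x) b ≡ nothing
  Ebase-emb-cut {inj₁ _} XY rewrite XY = refl
  Ebase-emb-cut {inj₂ _} XY rewrite XY = refl

  Ebase-from-z : ∀ {b} → Y (inj₁ b) ≡ true → PRN.Ebase N z b ≡ Ebase x₀ b
  Ebase-from-z Yb rewrite Yb = refl

  insert : Vtx O → List (Fin m) → Fin n → List (Fin (suc m))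
  insert x []       v = if X x ∧ Y (inj₁ v) then [ zero ] else []
  insert x (a ∷ as) v = if X x ∧ Y (inj₂ a) then zero ∷ suc a ∷ insert (inj₂ a) as v
                                            else suc a ∷ insert (inj₂ a) as v

  erase : List (Fin (suc m)) → List (Fin m)
  erase []           = []
  erase (zero ∷ as)  = erase as
  erase (suc a ∷ as) = a ∷ erase as

  erase-insert : ∀ x as v → erase (insert x as v) ≡ as
  erase-insert x []       v with X x ∧ Y (inj₁ v)
  ... | true  = refl
  ... | false = refl
  erase-insert x (a ∷ as) v with X x ∧ Y (inj₂ a)
  ... | true  = cong (a ∷_) (erase-insert (inj₂ a) as v)
  ... | false = cong (a ∷_) (erase-insert (inj₂ a) as v)

  ∈-insert : ∀ x as v {a} → a ∈ as → suc a ∈ insert x as v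
  ∈-insert x (b ∷ as) v a∈as with X x ∧ Y (inj₂ b) | a∈as
  ... | true  | here refl = there (here refl)
  ... | false | here refl = here refl
  ... | true  | there a∈ = there (there (∈-insert (inj₂ b) as v a∈))
  ... | false | there a∈ = there (∈-insert (inj₂ b) as v a∈)

  ∈-erase : ∀ as {a} → suc a ∈ as → a ∈ erase as
  ∈-erase (zero ∷ as)  (there a∈)  = ∈-erase as a∈
  ∈-erase (suc _ ∷ _)  (here refl) = here refl
  ∈-erase (suc _ ∷ as) (there a∈)  = there (∈-erase as a∈)

  Path-insert : ∀ x as {v q} → Path O x as v q → Path N (emb x) (insert x as v) v q
  Path-insert x [] {v} p with X x ∧ Y (inj₁ v) in XY
  ... | true  = let Xx , Yv = ∧-true⁻ XY in
                trans (Eaux-into-z x) Xx , trans (Ebase-from-z Yv) (trans (coherent x₀ x v x₀∈X Xx Yv) p)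
  ... | false = trans (Ebase-emb-kept XY) p
  Path-insert x (a ∷ as) (e , p) with X x ∧ Y (inj₂ a) in XY
  ... | true  = let Xx , Ya = ∧-true⁻ XY in trans (Eaux-into-z x) Xx , Ya , Path-insert (inj₂ a) as p
  ... | false = trans (Eaux-emb-kept XY) e , Path-insert (inj₂ a) as p

  Path-erase : ∀ x as {v q} → Path N (emb x) as v q →
               Path O x (erase as) v q × insert x (erase as) v ≡ as
  Path-erase-via-z : ∀ x as {v q} → X x ≡ true → Path N z as v q →
                     Path O x (erase as) v q × insert x (erase as) v ≡ zero ∷ as

  Path-erase x [] {v} p with X x ∧ Y (inj₁ v) in XY
  ... | false = trans (sym (Ebase-emb-kept XY)) p , refl
  ... | true  with () ← trans (sym (Ebase-emb-cut XY)) p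
  Path-erase x (zero ∷ as)  (e , p) = Path-erase-via-z x as (trans (sym (Eaux-into-z x)) e) p
  Path-erase x (suc a ∷ as) (e , p) with X x ∧ Y (inj₂ a) in XY | Path-erase (inj₂ a) as p
  ... | false | p′ , eq = (trans (sym (Eaux-emb-kept XY)) e , p′) , cong (suc a ∷_) eq
  ... | true  | _ with () ← trans (sym (Eaux-emb-cut XY)) e

  Path-erase-via-z x [] {v} Xx p with Y (inj₁ v) in Yv
  ... | true rewrite Xx = trans (coherent x x₀ v Xx x₀∈X Yv) p , refl
  ... | false with () ← p
  Path-erase-via-z x (zero ∷ _) _ (() , _)
  Path-erase-via-z x (suc a ∷ as) Xx (Ya , p) with Path-erase (inj₂ a) as p
  ... | p′ , eq rewrite Xx | Ya = (full-aux x a Xx Ya , p′) , cong (λ l → zero ∷ suc a ∷ l) eq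

  insert-embedding : WalkEmbedding O N
  insert-embedding = record
    { embed         = λ u as v → insert (inj₁ u) as v
    ; retract       = λ _ as _ → erase as
    ; embed-walk    = Path-insert _ _
    ; retract-embed = λ {u} {as} {v} _ → erase-insert (inj₁ u) as v
    }

  erase-embedding : WalkEmbedding N O
  erase-embedding = record
    { embed         = λ _ as _ → erase as
    ; retract       = λ u as v → insert (inj₁ u) as v
    ; embed-walk    = λ p → proj₁ (Path-erase _ _ p)
    ; retract-embed = λ p → proj₂ (Path-erase _ _ p)
    }

  module _ (onWalk : ∀ a → Walks.OnWalk O a) where
    open Walks N using (OnWalk; Entry; Exit; entry-base; onWalk-entry; onWalk-exit)

    onWalk-suc : ∀ a → OnWalk (suc a)
    onWalk-suc a =
      let u , v , as , w , a∈as = onWalk a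
      in u , v , insert (inj₁ u) as v , WalkEmbedding.embed-Walk insert-embedding w , ∈-insert (inj₁ u) as v a∈as

    entry-emb : ∀ x → Entry (emb x)
    entry-emb (inj₁ u) = entry-base u
    entry-emb (inj₂ a) = onWalk-entry (onWalk-suc a)

    exit-z : Exit z
    exit-z with Y-ne
    ... | inj₂ c , Yc = let v , ls , q , p = onWalk-exit (onWalk-suc c) in v , suc c ∷ ls , q , Yc , p
    ... | inj₁ b , Yb with Ebase x₀ b in x₀b
    ...   | just q  = b , [] , q , trans (Ebase-from-z Yb) x₀b
    ...   | nothing = ⊥-elim (full-base x₀ b x₀∈X Yb x₀b)

    onWalk-z : OnWalk zero
    onWalk-z =
      let open Entry (entry-emb x₀)
          v , ls , q , p = exit-z
      in source , v , prefix ++ zero ∷ ls , (q , extend (trans (Eaux-into-z x₀) x₀∈X , p)) , ∈-++⁺ʳ prefix (here refl)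

  strict-reduce : Strict O → Strict N
  strict-reduce s@(_ , _ , onWalk) = strict-reflect erase-embedding s λ
    { zero    → onWalk-z onWalk
    ; (suc a) → onWalk-suc onWalk a
    }

  strict-unreduce : Strict N → Strict O
  strict-unreduce s@(_ , _ , onWalk) = strict-reflect insert-embedding s onWalkO
    where
    onWalkO : ∀ a → Walks.OnWalk O a
    onWalkO a =
      let u , v , as , w , a∈as = onWalk (suc a)
      in u , v , erase as , WalkEmbedding.embed-Walk erase-embedding w , ∈-erase as a∈as

  realizes-reduce : ∀ {EG} → Realizes O EG → Realizes N EG
  realizes-reduce = realizes-transfer insert-embedding erase-embedding

  realizes-unreduce : ∀ {EG} → Realizes N EG → Realizes O EG
  realizes-unreduce = realizes-transfer erase-embedding insert-embedding

module _ {n : ℕ} {R R′ : PRN n} (i : R ≅ R′) (β : CoherentBiclique R′) where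
  open _≅_ i
  open Renaming i
  open CoherentBiclique β

  ≅-biclique : CoherentBiclique R
  ≅-biclique = record
    { X         = λ u → X (map₂ f u)
    ; Y         = λ u → Y (map₂ f u)
    ; x₀        = map₂ g x₀
    ; x₀∈X      = subst (λ w → X w ≡ true) (sym (map₂-f∘g x₀)) x₀∈X
    ; Y-ne      = let y , Yy = Y-ne in map₂ g y , subst (λ w → Y w ≡ true) (sym (map₂-f∘g y)) Yy
    ; disjoint  = λ v → disjoint (map₂ f v)
    ; full-aux  = λ x a Xx Ya → trans (pres-aux x a) (full-aux (map₂ f x) (f a) Xx Ya)
    ; full-base = λ x b Xx Yb e → full-base (map₂ f x) b Xx Yb (trans (sym (pres-base x b)) e)
    ; coherent  = λ x₁ x₂ b X₁ X₂ Yb →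
        trans (pres-base x₁ b) (trans (coherent (map₂ f x₁) (map₂ f x₂) b X₁ X₂ Yb) (sym (pres-base x₂ b)))
    }

  reduce-≅ : reduce R ≅-biclique ≅ reduce R′ β
  reduce-≅ = record
    { σ         = mk↔ₛ′ (lift f) (lift g) (lift-inverse f∘g) (lift-inverse g∘f)
    ; pres-aux  = aux
    ; pres-base = base
    }
    where
    lift : ∀ {k l} → (Fin k → Fin l) → Fin (suc k) → Fin (suc l)
    lift h zero    = zero
    lift h (suc a) = suc (h a)
    lift-inverse : ∀ {k l} {h : Fin k → Fin l} {h′ : Fin l → Fin k} →
                   (∀ a → h (h′ a) ≡ a) → ∀ a → lift h (lift h′ a) ≡ a
    lift-inverse inv zero    = refl
    lift-inverse inv (suc a) = cong suc (inv a)
    aux : ∀ u a → PRN.Eaux (reduce R ≅-biclique) u a ≡ PRN.Eaux (reduce R′ β) (map₂ (lift f) u) (lift f a)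
    aux (inj₁ b)       zero    = refl
    aux (inj₂ zero)    zero    = refl
    aux (inj₂ (suc c)) zero    = refl
    aux (inj₂ zero)    (suc a) = refl
    aux (inj₁ b)       (suc a) = cong (λ t → t ∧ not (X (inj₁ b) ∧ Y (inj₂ (f a)))) (pres-aux (inj₁ b) a)
    aux (inj₂ (suc c)) (suc a) = cong (λ t → t ∧ not (X (inj₂ (f c)) ∧ Y (inj₂ (f a)))) (pres-aux (inj₂ c) a)
    base : ∀ u b → PRN.Ebase (reduce R ≅-biclique) u b ≡ PRN.Ebase (reduce R′ β) (map₂ (lift f) u) b
    base (inj₁ c)       b = cong (if X (inj₁ c) ∧ Y (inj₁ b) then nothing else_) (pres-base (inj₁ c) b)
    base (inj₂ (suc c)) b = cong (if X (inj₂ (f c)) ∧ Y (inj₁ b) then nothing else_) (pres-base (inj₂ c) b)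
    base (inj₂ zero)    b = cong (if Y (inj₁ b) then_else nothing)
      (trans (pres-base (map₂ g x₀) b) (cong (λ w → PRN.Ebase R′ w b) (map₂-f∘g x₀)))

-- A derivation renames only at its end, so appending a reduction step means
-- pulling the biclique back along that renaming.
↪*-snoc : ∀ {n} {R₁ R₂ R₃ : PRN n} → R₁ ↪* R₂ → (β : CoherentBiclique R₂) → reduce R₂ β ≅ R₃ → R₁ ↪* R₃
↪*-snoc (step γ r) β i = step γ (↪*-snoc r β i)
↪*-snoc (done j)   β i = step (≅-biclique j β) (done (≅-trans (reduce-≅ j β) i))

↪*-sound : ∀ {n} {EG : PolGraph n} {R R′ : PRN n} → R ↪* R′ →
           Strict R × Realizes R EG → Strict R′ × Realizes R′ EG
↪*-sound (done i)      (s , r) = strict-≅ i s , realizes-≅ i r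
↪*-sound (step β rest) (s , r) = ↪*-sound rest (Reduction.strict-reduce _ β s , Reduction.realizes-reduce _ β r)

module Polarization {n : ℕ} {D : Diagram n} {EG : PolGraph n} (P : IsPolarization D EG) where
  open Diagram D
  open IsPolarization P

  loopFree : LoopFree EG
  loopFree u with EG u u in uu
  ... | nothing  = refl
  ... | just pos with () ← trans (sym (pos-dir u u uu)) (dir-irr u)
  ... | just neg with () ← trans (sym (neg-und u u uu)) (und-irr u)

  asymmetric : ∀ u v {q q′} → EG u v ≡ just q → EG v u ≡ just q′ → ⊥
  asymmetric u v {pos} {pos} uv vu with () ← trans (sym (pos-dir v u vu)) (dir-asym u v (pos-dir u v uv))
  asymmetric u v {pos} {neg} uv vu with () ← trans (sym (pos-dir u v uv)) (und-dir u v (trans (und-sym u v) (neg-und v u vu)))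
  asymmetric u v {neg} {pos} uv vu with () ← trans (sym (pos-dir v u vu)) (und-dir v u (trans (und-sym v u) (neg-und u v uv)))
  asymmetric u v {neg} {neg} uv vu = one-way u v uv vu

  strict-initial : Strict (initialPRN EG)
  strict-initial = (λ { _ _ _ [] [] _ _ → refl })
                 , (λ { u v _ [] [] (_ , uv) (_ , vu) → asymmetric u v uv vu })
                 , (λ ())

  realizes-initial : Realizes (initialPRN EG) EG
  realizes-initial u v = (λ _ uv → [] , uv) , λ { uv∉G [] (_ , uv) → nothing≢just (trans (sym uv∉G) uv) }
    where
    nothing≢just : ∀ {q} → nothing ≢ just q
    nothing≢just ()

-- Undoing the reduction that created the auxiliary vertex zero: X and Y are
-- its in- and out-neighbours, and O replaces it by all edges X × Y.
module Unreduction {n k : ℕ} {EG : PolGraph n} (loopFree : LoopFree EG)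
  (Ea : Fin n ⊎ Fin (suc k) → Fin (suc k) → Bool) (Eb : Fin n ⊎ Fin (suc k) → Fin n → Maybe Pol)
  (loopless : Loopless (prn (suc k) Ea Eb)) (strict : Strict (prn (suc k) Ea Eb))
  (realizes : Realizes (prn (suc k) Ea Eb) EG) where

  R : PRN n
  R = prn (suc k) Ea Eb

  open Walks R using (OnWalk; Path-inEdge; onWalk-exit; Path-unique)

  z : Vtx R
  z = inj₂ zero

  emb : Fin n ⊎ Fin k → Vtx R
  emb = map₂ suc

  X Y : Fin n ⊎ Fin k → Bool
  X x        = Ea (emb x) zero
  Y (inj₁ b) = is-just (Eb z b)
  Y (inj₂ a) = Ea z (suc a)

  O : PRN n
  O = prn k (λ x a → Ea (emb x) (suc a) ∨ (X x ∧ Y (inj₂ a)))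
            (λ x b → if X x ∧ Y (inj₁ b) then Eb z b else Eb (emb x) b)

  onWalk : ∀ a → OnWalk a
  onWalk = proj₂ (proj₂ strict)

  path-unique : ∀ {x l₁ l₂ v q₁ q₂} → Path R x l₁ v q₁ → Path R x l₂ v q₂ → l₁ ≡ l₂
  path-unique = Path-unique loopFree strict realizes

  no-aux-shortcut : ∀ x a → X x ≡ true × Y (inj₂ a) ≡ true → Ea (emb x) (suc a) ≡ false
  no-aux-shortcut x a (Xx , Ya) = ¬-not λ shortcut →
    let _ , ls , _ , p = onWalk-exit (onWalk (suc a))
    in case ∷-injectiveˡ (path-unique (shortcut , p) (Xx , Ya , p)) of λ ()

  no-base-shortcut : ∀ x b → X x ≡ true → Y (inj₁ b) ≡ true → Eb (emb x) b ≡ nothing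
  no-base-shortcut x b Xx Yb with Eb (emb x) b in shortcut
  ... | nothing = refl
  ... | just _  = let _ , zb = is-just⇒just Yb in case path-unique {l₁ = []} shortcut (Xx , zb) of λ ()

  disjoint : ∀ v → X v ≡ true → Y v ≡ true → ⊥
  disjoint (inj₁ b) Xb Yb =
    let q , zb = is-just⇒just Yb in proj₂ (realizes b b) (loopFree b) [ zero ] (q , Xb , zb)
  disjoint (inj₂ a) Xa Ya =
    let _ , ls , _ , p = onWalk-exit (onWalk zero)
    in case ++-identityˡ-unique (suc a ∷ zero ∷ []) (path-unique p (Ya , Xa , p)) of λ ()

  X∧Y≡false : ∀ v → X v ∧ Y v ≡ false
  X∧Y≡false v = ¬-not λ XY → let Xv , Yv = ∧-true⁻ XY in disjoint v Xv Yv

  X-nonempty : ∃ λ x → X x ≡ true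
  X-nonempty = let _ , _ , _ , (_ , p) , z∈as = onWalk zero in from-inEdge (Path-inEdge p z∈as)
    where
    from-inEdge : (∃ λ w → Ea w zero ≡ true) → ∃ λ x → X x ≡ true
    from-inEdge (inj₁ b , e)       = inj₁ b , e
    from-inEdge (inj₂ (suc c) , e) = inj₂ c , e
    from-inEdge (inj₂ zero , e)    with () ← trans (sym e) (proj₁ loopless zero)

  Y-nonempty : ∃ λ y → Y y ≡ true
  Y-nonempty with onWalk-exit (onWalk zero)
  ... | v , []         , _ , p       = inj₁ v , cong is-just p
  ... | _ , suc c ∷ _  , _ , (e , _) = inj₂ c , e
  ... | _ , zero ∷ _   , _ , (e , _) with () ← trans (sym e) (proj₁ loopless zero)

  β : CoherentBiclique O
  β = record
    { X         = X
    ; Y         = Y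
    ; x₀        = proj₁ X-nonempty
    ; x₀∈X      = proj₂ X-nonempty
    ; Y-ne      = Y-nonempty
    ; disjoint  = disjoint
    ; full-aux  = λ x a Xx Ya → full-aux x a Xx Ya
    ; full-base = λ x b Xx Yb → full-base x b Xx Yb
    ; coherent  = coherent
    }
    where
    full-aux : ∀ x a → X x ≡ true → Y (inj₂ a) ≡ true → PRN.Eaux O x a ≡ true
    full-aux x a Xx Ya rewrite Xx | Ya = ∨-zeroʳ (Ea (emb x) (suc a))
    full-base : ∀ x b → X x ≡ true → Y (inj₁ b) ≡ true → PRN.Ebase O x b ≢ nothing
    full-base x b Xx Yb rewrite Xx | Yb with is-just⇒just Yb
    ... | _ , zb rewrite zb = λ ()
    coherent : ∀ x₁ x₂ b → X x₁ ≡ true → X x₂ ≡ true → Y (inj₁ b) ≡ true → PRN.Ebase O x₁ b ≡ PRN.Ebase O x₂ b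
    coherent x₁ x₂ b X₁ X₂ Yb rewrite X₁ | X₂ | Yb = refl

  reduce-O-≅ : reduce O β ≅ R
  reduce-O-≅ = pointwise-≅ aux base
    where
    aux-emb : ∀ x a → newAux O β (just x) (suc a) ≡ Ea (emb x) (suc a)
    aux-emb x a = ∨-∧-not-cancel _ _ (λ XY → no-aux-shortcut x a (∧-true⁻ XY))
    aux : ∀ u a → PRN.Eaux (reduce O β) u a ≡ Ea u a
    aux (inj₁ b)       zero    = refl
    aux (inj₂ (suc c)) zero    = refl
    aux (inj₂ zero)    zero    = sym (proj₁ loopless zero)
    aux (inj₂ zero)    (suc a) = refl
    aux (inj₁ b)       (suc a) = aux-emb (inj₁ b) a
    aux (inj₂ (suc c)) (suc a) = aux-emb (inj₂ c) a
    base-emb : ∀ x b → newBase O β (just x) b ≡ Eb (emb x) b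
    base-emb x b with X x ∧ Y (inj₁ b) in XY
    ... | false = refl
    ... | true  = let Xx , Yb = ∧-true⁻ XY in sym (no-base-shortcut x b Xx Yb)
    base-z : ∀ b → PRN.Ebase (reduce O β) z b ≡ Eb z b
    base-z b with Eb z b in zb
    ... | nothing = refl
    ... | just _ rewrite proj₂ X-nonempty = refl
    base : ∀ u b → PRN.Ebase (reduce O β) u b ≡ Eb u b
    base (inj₁ c)       = base-emb (inj₁ c)
    base (inj₂ (suc c)) = base-emb (inj₂ c)
    base (inj₂ zero)    = base-z

  loopless-O : Loopless O
  loopless-O = (λ a → trans (cong (_∨ (X (inj₂ a) ∧ Y (inj₂ a))) (proj₁ loopless (suc a))) (X∧Y≡false (inj₂ a)))
             , (λ b → trans (cong (if_then Eb z b else Eb (inj₁ b) b) (X∧Y≡false (inj₁ b))) (proj₂ loopless b))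

  strict-O : Strict O
  strict-O = Reduction.strict-unreduce O β (strict-≅ (≅-sym reduce-O-≅) strict)

  realizes-O : Realizes O EG
  realizes-O = Reduction.realizes-unreduce O β (realizes-≅ (≅-sym reduce-O-≅) realizes)

initial-≅ : ∀ {n} {EG : PolGraph n} {Ea Eb} → Realizes (prn 0 Ea Eb) EG → initialPRN EG ≅ prn 0 Ea Eb
initial-≅ {EG = EG} {Eb = Eb} realizes = pointwise-≅ (λ _ ()) base
  where
  base : ∀ u b → PRN.Ebase (initialPRN EG) u b ≡ Eb u b
  base (inj₁ u) b with EG u b in uv
  ... | just q with proj₁ (realizes u b) q uv
  ...   | [] , p = sym p
  base (inj₁ u) b | nothing with Eb (inj₁ u) b in e
  ...   | nothing = refl
  ...   | just q  = ⊥-elim (proj₂ (realizes u b) uv [] (q , e))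

↪*-complete : ∀ {n} {EG : PolGraph n} → LoopFree EG → ∀ k Ea Eb →
              Loopless (prn k Ea Eb) → Strict (prn k Ea Eb) → Realizes (prn k Ea Eb) EG →
              initialPRN EG ↪* prn k Ea Eb
↪*-complete loopFree zero    _  _  _        _      realizes = done (initial-≅ realizes)
↪*-complete loopFree (suc k) Ea Eb loopless strict realizes =
  ↪*-snoc (↪*-complete loopFree k _ _ loopless-O strict-O realizes-O) β reduce-O-≅
  where open Unreduction loopFree Ea Eb loopless strict realizes

theorem36 : {n : ℕ} (D : Diagram n) (EG : PolGraph n) → IsPolarization D EG →
    (R : PRN n) → Loopless R →
    (initialPRN EG ↪* R) ⇔ (Strict R × Realizes R EG)
theorem36 D EG P R loopless = mk⇔
  (λ r → ↪*-sound r (strict-initial , realizes-initial))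
  (λ (strict , realizes) → ↪*-complete loopFree (PRN.m R) (PRN.Eaux R) (PRN.Ebase R) loopless strict realizes)
  where open Polarization P
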